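{- Let $k\geq 0$, $n\geq 3$, $M=3n$ and $t\in\{0,1\}$ be integers. If $M\equiv t$ or $M\equiv 3-t\pmod 4$, then there exists a zero-sum $(3\cdot n;k;t)$-Skolem system of size $M$ and order $n$.
   Context: $[a,b]$ denotes $\{a,\ldots,b\}$. Let $m_1,\ldots,m_n\geq 3$ be integers, $M=\sum_i m_i$, $k\geq 0$ an integer and $t\in\{0,1\}$. An $(m_1,\ldots,m_n;k;t)$-Skolem system of order $n$ and size $M$ is a family $S=\{D_1,\ldots,D_n\}$ of sequences of integers such that $|D_i|=m_i$, the entries of each $D_i$ sum to $0$, and, writing $abs(D_i)$ for the set of absolute values of the entries of $D_i$, the sets $abs(D_1),\ldots,abs(D_n)$ form a partition of $[1,r]\cup[r+1+k,M+k-1]\cup\{M+k+t\}$ for some positive integer $r$. A $(3\cdot n;k;t)$-Skolem system is one with all $m_i=3$. Such a system is zero-sum if one can choose $d_i\in D_i$ for each $1\leq i\leq n$ with $\sum_{i=1}^n d_i=0$. -}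

module Defs where

open import Data.Nat using (ℕ; zero; suc; _+_; _*_; _∸_; _≤_; _≥_)
open import Data.Integer as ℤ using (ℤ; ∣_∣)
open import Data.Fin using (Fin; zero; suc)
open import Data.List using (List; length; map; foldr)
open import Data.List.Membership.Propositional using (_∈_)
open import Data.Product using (Σ; ∃; _×_; _,_)
open import Data.Sum using (_⊎_)
open import Relation.Binary.PropositionalEquality using (_≡_; _≢_)
open import Relation.Nullary using (¬_)

sumFinℕ : {n : ℕ} → (Fin n → ℕ) → ℕ
sumFinℕ {zero}  f = 0
sumFinℕ {suc n} f = f zero + sumFinℕ (λ i → f (suc i))

sumFinℤ : {n : ℕ} → (Fin n → ℤ) → ℤ
sumFinℤ {zero}  f = ℤ.0ℤ
sumFinℤ {suc n} f = f zero ℤ.+ sumFinℤ (λ i → f (suc i))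

sumℤ : List ℤ → ℤ
sumℤ = foldr ℤ._+_ ℤ.0ℤ

-- abs(D): the (multi)set of absolute values of the entries of D, as a list;
-- only membership in it is ever used, so it is a set
absList : List ℤ → List ℕ
absList = map ∣_∣

InTarget : (M k t r : ℕ) → ℕ → Set
InTarget M k t r x =
  (1 ≤ x × x ≤ r) ⊎ ((r + 1 + k ≤ x × x ≤ M + k ∸ 1) ⊎ x ≡ M + k + t)

IsPartitionOf : {n : ℕ} → (Fin n → List ℤ) → (ℕ → Set) → Set
IsPartitionOf {n} D T =
  (∀ (i : Fin n) (x : ℕ) → x ∈ absList (D i) → T x)
  × (∀ (x : ℕ) → T x → ∃ λ (i : Fin n) → x ∈ absList (D i))
  × (∀ (i j : Fin n) (x : ℕ) → x ∈ absList (D i) → x ∈ absList (D j) → i ≡ j)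

IsSkolemSystem : {n : ℕ} → (m : Fin n → ℕ) → (k t : ℕ) → (Fin n → List ℤ) → Set
IsSkolemSystem {n} m k t D =
  (∀ (i : Fin n) → m i ≥ 3)
  × (∀ (i : Fin n) → length (D i) ≡ m i)
  × (∀ (i : Fin n) → sumℤ (D i) ≡ ℤ.0ℤ)
  × (∃ λ (r : ℕ) → r ≥ 1 × IsPartitionOf D (InTarget (sumFinℕ m) k t r))

Is3SkolemSystem : (n k t : ℕ) → (Fin n → List ℤ) → Set
Is3SkolemSystem n k t D = IsSkolemSystem {n} (λ _ → 3) k t D

IsZeroSum : {n : ℕ} → (Fin n → List ℤ) → Set
IsZeroSum {n} D =
  ∃ λ (d : Fin n → ℤ) → (∀ (i : Fin n) → d i ∈ D i) × sumFinℤ d ≡ ℤ.0ℤ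

-- Each pair of positions p, p + d of a (hooked) Skolem sequence of order n gives the triple
-- (d, n + k + p, -(n + k + p + d)), which sums to zero; over all pairs the absolute values run
-- through [1, n] ∪ (n + k + ([1, 2n - 1] ∪ {2n + t})), the required set for r = n. Skolem
-- sequences exist for n ≡ 0, 1 and hooked ones for n ≡ 2, 3 (mod 4), which is what the
-- condition on 3n mod 4 says. For each residue they are given as a family in a parameter x,
-- built from runs of nested pairs whose data are linear forms in x, and checked for all x at
-- once by comparing these forms. For the zero sum pick ±d from every triple, with signs
-- periodic mod 4; where that leaves a nonzero total (n ≡ 1, 2), two triples contribute their
-- other entries instead, whose n + k parts cancel.

module Submission where

open import Defs
open import Data.Bool using (Bool; true; false; not; T)
open import Data.Empty using (⊥; ⊥-elim)
open import Data.Fin using (Fin; zero; suc; #_)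
open import Data.Integer as ℤ using (ℤ; +_; -_; ∣_∣; 0ℤ)
import Data.Integer.Properties as ℤ
import Data.Integer.Tactic.RingSolver as ℤ-Solver
open import Data.List using (List; []; _∷_; _++_; [_]; map; concat; length; lookup)
import Data.List.Properties as List
open import Data.List.Membership.Propositional using (_∈_)
open import Data.List.Membership.Propositional.Properties
  using (∈-++⁺ˡ; ∈-++⁺ʳ; ∈-++⁻; ∈-map⁺; ∈-lookup; ∈-concat⁻; ∈-concat⁺′)
open import Data.List.Relation.Unary.All using (All; []; _∷_)
import Data.List.Relation.Unary.All as All
import Data.List.Relation.Unary.All.Properties as All
open import Data.List.Relation.Unary.AllPairs using ([]; _∷_)
open import Data.List.Relation.Unary.Any using (here; there)
import Data.List.Relation.Unary.Any as Any
import Data.List.Relation.Unary.Any.Properties as Any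
open import Data.List.Relation.Unary.Unique.Propositional using (Unique)
open import Data.List.Relation.Binary.Permutation.Propositional
  using (_↭_; ↭-refl; ↭-sym; ↭-trans; ↭-reflexive; ↭-prep; ↭⇒↭ₛ; module PermutationReasoning)
open import Data.List.Relation.Binary.Permutation.Propositional.Properties
  using (++⁺; ++⁺ˡ; map⁺; shift; shifts; ∷↭∷ʳ; ∈-resp-↭; ↭-length)
import Data.List.Relation.Binary.Permutation.Setoid.Properties as Permutationₛ
open import Data.Maybe using (Maybe; just; nothing; is-just; to-witness-T)
open import Data.Nat
  using (ℕ; zero; suc; _+_; _*_; _∸_; _≤_; _≥_; _<_; _%_; _/_; _≟_; _≤?_; z≤n; s≤s; z<s)
open import Data.Nat.DivMod using (m≡m%n+[m/n]*n; m%n<n; %-distribˡ-*)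
open import Data.Nat.Properties
  using (*-comm; *-distribʳ-+; *-identityˡ; *-suc; *-zeroʳ; +-comm; +-identityʳ; +-suc;
         <-≤-trans; <⇒≢; <⇒≤; <⇒≱; m+[n∸m]≡n; m<m+n; m≤m+n; m≤n⇒m<n∨m≡n;
         ≤-pred; ≤-reflexive; ≤-refl; ≤-trans)
open import Data.Nat.Tactic.RingSolver using (solve-∀)
open import Data.Product using (Σ; ∃; _×_; _,_; proj₁; proj₂)
open import Data.Sum using (_⊎_; inj₁; inj₂)
import Data.Sum as Sum
open import Function using (_∘_)
open import Relation.Binary.Definitions using (DecidableEquality)
open import Relation.Binary.PropositionalEquality hiding ([_])
open import Relation.Nullary using (Dec; yes; no; contradiction)
open import Relation.Nullary.Decidable using (map′; _×-dec_)

-- Arithmetic progressions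

progression : (step start length : ℕ) → List ℕ
progression s a zero    = []
progression s a (suc l) = a ∷ progression s (s + a) l

range : ℕ → ℕ → List ℕ
range = progression 1

length-progression : ∀ s a l → length (progression s a l) ≡ l
length-progression s a zero    = refl
length-progression s a (suc l) = cong suc (length-progression s (s + a) l)

progression-++ : ∀ s a l m →
  progression s a (l + m) ≡ progression s a l ++ progression s (s * l + a) m
progression-++ s a zero    m = cong (λ b → progression s (b + a) m) (sym (*-zeroʳ s))
progression-++ s a (suc l) m = cong (a ∷_) (begin
  progression s (s + a) (l + m)
    ≡⟨ progression-++ s (s + a) l m ⟩
  progression s (s + a) l ++ progression s (s * l + (s + a)) m
    ≡⟨ cong (λ b → progression s (s + a) l ++ progression s b m) (shuffle l s a) ⟩
  progression s (s + a) l ++ progression s (s * suc l + a) m ∎)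
  where
  open ≡-Reasoning
  shuffle : ∀ l s a → s * l + (s + a) ≡ s * suc l + a
  shuffle = solve-∀

range-suc : ∀ a l → range a (suc l) ≡ range a l ++ [ l + a ]
range-suc a zero    = refl
range-suc a (suc l) =
  cong (a ∷_) (trans (range-suc (suc a) l) (cong (λ b → range (suc a) l ++ [ b ]) (+-suc l a)))

range-++ : ∀ a l m → range a (l + m) ≡ range a l ++ range (a + l) m
range-++ a l m = trans (progression-++ 1 a l m)
  (cong (λ b → range a l ++ range b m) (trans (cong (_+ a) (*-identityˡ l)) (+-comm l a)))

map-+-progression : ∀ c s a l → map (_+_ c) (progression s a l) ≡ progression s (c + a) l
map-+-progression c s a zero    = refl
map-+-progression c s a (suc l) =
  cong (c + a ∷_) (trans (map-+-progression c s (s + a) l) (cong (λ b → progression s b l) (swap c s a)))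
  where
  swap : ∀ c s a → c + (s + a) ≡ s + (c + a)
  swap = solve-∀

∈-range⁻ : ∀ {x} a l → x ∈ range a l → a ≤ x × x < a + l
∈-range⁻ a (suc l) (here refl) = ≤-refl , m<m+n a z<s
∈-range⁻ {x} a (suc l) (there x∈) with ∈-range⁻ (suc a) l x∈
... | a<x , x<a+l = <⇒≤ a<x , subst (x <_) (sym (+-suc a l)) x<a+l

∈-range⁺ : ∀ {x} a l → a ≤ x → x < a + l → x ∈ range a l
∈-range⁺ {x} a zero    a≤x x<a = contradiction a≤x (<⇒≱ (subst (x <_) (+-identityʳ a) x<a))
∈-range⁺ {x} a (suc l) a≤x x<a with m≤n⇒m<n∨m≡n a≤x
... | inj₂ refl = here refl
... | inj₁ a<x  = there (∈-range⁺ (suc a) l a<x (subst (x <_) (+-suc a l) x<a))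

range-++-unique : ∀ a l {ys} → All (a + l ≤_) ys → Unique ys → Unique (range a l ++ ys)
range-++-unique a zero    {ys} ys≥ ys! = ys!
range-++-unique a (suc l) {ys} ys≥ ys! =
  All.++⁺ (All.tabulate λ y∈ → <⇒≢ (proj₁ (∈-range⁻ (suc a) l y∈)))
          (All.map (λ a+l<y → <⇒≢ (<-≤-trans (m<m+n a z<s) a+l<y)) ys≥)
  ∷ range-++-unique (suc a) l (All.map (λ {y} → subst (_≤ y) (+-suc a l)) ys≥) ys!

interleave : ∀ a l → progression 2 a l ++ progression 2 (suc a) l ↭ range a (l + l)
interleave a zero    = ↭-refl
interleave a (suc l) = ↭-prep a (begin
  progression 2 (2 + a) l ++ suc a ∷ progression 2 (3 + a) l ↭⟨ shift (suc a) (progression 2 (2 + a) l) _ ⟩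
  suc a ∷ progression 2 (2 + a) l ++ progression 2 (3 + a) l ↭⟨ ↭-prep (suc a) (interleave (2 + a) l) ⟩
  range (suc a) (suc (l + l))                                ≡⟨ cong (range (suc a)) (+-suc l l) ⟨
  range (suc a) (l + suc l)                                  ∎)
  where open PermutationReasoning

interleave-odd : ∀ a l → progression 2 a (suc l) ++ progression 2 (suc a) l ↭ range a (suc (l + l))
interleave-odd a zero    = ↭-refl
interleave-odd a (suc l) = ↭-prep a (begin
  progression 2 (2 + a) (suc l) ++ suc a ∷ progression 2 (3 + a) l
    ↭⟨ shift (suc a) (progression 2 (2 + a) (suc l)) _ ⟩
  suc a ∷ progression 2 (2 + a) (suc l) ++ progression 2 (3 + a) l
    ↭⟨ ↭-prep (suc a) (interleave-odd (2 + a) l) ⟩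
  suc a ∷ range (2 + a) (suc (l + l))
    ≡⟨ cong (λ m → suc a ∷ range (2 + a) m) (+-suc l l) ⟨
  range (suc a) (suc l + suc l) ∎)
  where open PermutationReasoning

interleave-halves : ∀ o e → o ≡ e ⊎ o ≡ suc e →
  progression 2 1 o ++ progression 2 2 e ↭ range 1 (o + e)
interleave-halves o e (inj₁ refl) = interleave 1 e
interleave-halves o e (inj₂ refl) = interleave-odd 1 e

-- Linear forms and tilings

-- The constructions are families indexed by x ∈ ℕ whose numerical data are linear forms
-- a x + b. Forms that agree coefficientwise agree at every x, so a tiling found by matching
-- forms is a tiling for all x simultaneously.

infix 9 _x+_
infixl 7 _⊛_
infixl 6 _⊕_

record Lin : Set where
  constructor _x+_
  field
    slope offset : ℕ

⟦_⟧ : Lin → ℕ → ℕ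
⟦ a x+ b ⟧ x = b + a * x

sucₗ : Lin → Lin
sucₗ (a x+ b) = a x+ suc b

_⊕_ : Lin → Lin → Lin
(a x+ b) ⊕ (c x+ d) = (a + c) x+ (b + d)

_⊛_ : ℕ → Lin → Lin
s ⊛ (a x+ b) = (s * a) x+ (s * b)

_∸ₗ_ : Lin → Lin → Lin
(a x+ b) ∸ₗ (c x+ d) = (a ∸ c) x+ (b ∸ d)

_≤ₗ_ : Lin → Lin → Set
(a x+ b) ≤ₗ (c x+ d) = a ≤ c × b ≤ d

_≟ₗ_ : DecidableEquality Lin
(a x+ b) ≟ₗ (c x+ d) =
  map′ (λ (a≡c , b≡d) → cong₂ _x+_ a≡c b≡d) (λ { refl → refl , refl }) (a ≟ c ×-dec b ≟ d)

_≤ₗ?_ : ∀ f g → Dec (f ≤ₗ g)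
(a x+ b) ≤ₗ? (c x+ d) = a ≤? c ×-dec b ≤? d

⟦⊕⟧ : ∀ f g x → ⟦ f ⊕ g ⟧ x ≡ ⟦ f ⟧ x + ⟦ g ⟧ x
⟦⊕⟧ (a x+ b) (c x+ d) x = lemma a b c d x
  where
  lemma : ∀ a b c d x → b + d + (a + c) * x ≡ b + a * x + (d + c * x)
  lemma = solve-∀

⟦⊛⟧ : ∀ s f x → ⟦ s ⊛ f ⟧ x ≡ s * ⟦ f ⟧ x
⟦⊛⟧ s (a x+ b) x = lemma s a b x
  where
  lemma : ∀ s a b x → s * b + s * a * x ≡ s * (b + a * x)
  lemma = solve-∀

⟦∸ₗ⟧ : ∀ {f g} x → f ≤ₗ g → ⟦ f ⟧ x + ⟦ g ∸ₗ f ⟧ x ≡ ⟦ g ⟧ x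
⟦∸ₗ⟧ {a x+ b} {c x+ d} x (a≤c , b≤d) = begin
  b + a * x + ((d ∸ b) + (c ∸ a) * x) ≡⟨ lemma b (a * x) (d ∸ b) ((c ∸ a) * x) ⟩
  (b + (d ∸ b)) + (a * x + (c ∸ a) * x) ≡⟨ cong₂ _+_ (m+[n∸m]≡n b≤d) (sym (*-distribʳ-+ x a (c ∸ a))) ⟩
  d + (a + (c ∸ a)) * x                ≡⟨ cong (λ e → d + e * x) (m+[n∸m]≡n a≤c) ⟩
  d + c * x                            ∎
  where
  open ≡-Reasoning
  lemma : ∀ p q r s → p + q + (r + s) ≡ (p + r) + (q + s)
  lemma = solve-∀

Segment : Set
Segment = Lin × Lin

segment : (step x : ℕ) → Segment → List ℕ
segment s x (a , l) = progression s (⟦ a ⟧ x) (⟦ l ⟧ x)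

segments : (step x : ℕ) → List Segment → List ℕ
segments s x = concat ∘ map (segment s x)

segment-split : ∀ s x a {l₁ l} → l₁ ≤ₗ l →
  segment s x (a , l) ≡ segment s x (a , l₁) ++ segment s x (s ⊛ l₁ ⊕ a , l ∸ₗ l₁)
segment-split s x a {l₁} {l} l₁≤l = begin
  progression s (⟦ a ⟧ x) (⟦ l ⟧ x)
    ≡⟨ cong (progression s (⟦ a ⟧ x)) (sym (⟦∸ₗ⟧ x l₁≤l)) ⟩
  progression s (⟦ a ⟧ x) (⟦ l₁ ⟧ x + ⟦ l ∸ₗ l₁ ⟧ x)
    ≡⟨ progression-++ s (⟦ a ⟧ x) (⟦ l₁ ⟧ x) (⟦ l ∸ₗ l₁ ⟧ x) ⟩
  progression s (⟦ a ⟧ x) (⟦ l₁ ⟧ x) ++ progression s (s * ⟦ l₁ ⟧ x + ⟦ a ⟧ x) (⟦ l ∸ₗ l₁ ⟧ x)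
    ≡⟨ cong (λ b → segment s x (a , l₁) ++ progression s b (⟦ l ∸ₗ l₁ ⟧ x)) start ⟩
  segment s x (a , l₁) ++ segment s x (s ⊛ l₁ ⊕ a , l ∸ₗ l₁) ∎
  where
  open ≡-Reasoning
  start : s * ⟦ l₁ ⟧ x + ⟦ a ⟧ x ≡ ⟦ s ⊛ l₁ ⊕ a ⟧ x
  start = sym (trans (⟦⊕⟧ (s ⊛ l₁) a x) (cong (_+ ⟦ a ⟧ x) (⟦⊛⟧ s l₁ x)))

Splitting : (step : ℕ) → List Segment → Segment → Set
Splitting s σs τ = Σ (List Segment) λ rest → ∀ x → segments s x σs ↭ segment s x τ ++ segments s x rest

extract : ∀ s a σs → Maybe (Σ Lin λ l → Splitting s σs (a , l))
extract s a [] = nothing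
extract s a ((b , l) ∷ σs) with b ≟ₗ a
... | yes refl = just (l , σs , λ _ → ↭-refl)
... | no _ with extract s a σs
...   | nothing = nothing
...   | just (l′ , rest , p) = just (l′ , (b , l) ∷ rest , λ x →
          ↭-trans (++⁺ˡ (segment s x (b , l)) (p x))
                  (shifts (segment s x (b , l)) (segment s x (a , l′))))

splitting-join : ∀ {s σs rest a l₁ l} → l₁ ≤ₗ l →
  (∀ x → segments s x σs ↭ segment s x (a , l₁) ++ segments s x rest) →
  Splitting s rest (s ⊛ l₁ ⊕ a , l ∸ₗ l₁) → Splitting s σs (a , l)
splitting-join {s} {σs} {rest} {a} {l₁} {l} l₁≤l p (rest′ , q) = rest′ , λ x → begin
  segments s x σs                                    ↭⟨ p x ⟩
  first x ++ segments s x rest                       ↭⟨ ++⁺ˡ (first x) (q x) ⟩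
  first x ++ second x ++ segments s x rest′          ≡⟨ List.++-assoc (first x) (second x) _ ⟨
  (first x ++ second x) ++ segments s x rest′        ≡⟨ cong (_++ segments s x rest′) (segment-split s x a l₁≤l) ⟨
  segment s x (a , l) ++ segments s x rest′          ∎
  where
  open PermutationReasoning
  first second : ℕ → List ℕ
  first  x = segment s x (a , l₁)
  second x = segment s x (s ⊛ l₁ ⊕ a , l ∸ₗ l₁)

coverSegment : (fuel s : ℕ) (a l : Lin) (σs : List Segment) → Maybe (Splitting s σs (a , l))
coverSegment fuel s a l σs with l ≟ₗ (0 x+ 0)
... | yes refl = just (σs , λ _ → ↭-refl)
... | no _ with fuel | extract s a σs
...   | zero     | _       = nothing
...   | suc _    | nothing = nothing
...   | suc fuel | just (l₁ , rest , p) with l₁ ≤ₗ? l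
...     | no _     = nothing
...     | yes l₁≤l with coverSegment fuel s (s ⊛ l₁ ⊕ a) (l ∸ₗ l₁) rest
...       | nothing   = nothing
...       | just next = just (splitting-join {σs = σs} {rest = rest} l₁≤l p next)

cover : (s : ℕ) (τs σs : List Segment) → Maybe (∀ x → segments s x σs ↭ segments s x τs)
cover s []            []      = just λ _ → ↭-refl
cover s []            (_ ∷ _) = nothing
cover s ((a , l) ∷ τs) σs with coverSegment (length σs) s a l σs
... | nothing         = nothing
... | just (rest , p) with cover s τs rest
...   | nothing = nothing
...   | just q  = just λ x → ↭-trans (p x) (++⁺ˡ (segment s x (a , l)) (q x))

-- decided by evaluation: on closed data a proof is `_`
Tiles : (step : ℕ) (τs σs : List Segment) → Set
Tiles s τs σs = T (is-just (cover s τs σs))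

tiles⇒↭ : ∀ s τs σs → Tiles s τs σs → ∀ x → segments s x σs ↭ segments s x τs
tiles⇒↭ s τs σs = to-witness-T (cover s τs σs)

-- Skolem sequences from runs of nested pairs

Pair : Set
Pair = ℕ × ℕ

right : Pair → ℕ
right (p , d) = p + d

differences : List Pair → List ℕ
differences = map proj₂

positions : List Pair → List ℕ
positions ps = map proj₁ ps ++ map right ps

-- The number d occupies positions p and p + d for each (p , d); for t = 1 the
-- sequence is hooked: position 2n stays empty and 2n + 1 is used instead.
IsSkolemSequence : (n t : ℕ) → List Pair → Set
IsSkolemSequence n t ps =
  differences ps ↭ range 1 n × positions ps ↭ range 1 (2 * n ∸ 1) ++ [ 2 * n + t ]

nestedPairs : (u g l : ℕ) → List Pair
nestedPairs u g zero    = []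
nestedPairs u g (suc l) = (l + u , suc g) ∷ nestedPairs u (2 + g) l

differences-nestedPairs : ∀ u g l → differences (nestedPairs u g l) ≡ progression 2 (suc g) l
differences-nestedPairs u g zero    = refl
differences-nestedPairs u g (suc l) = cong (suc g ∷_) (differences-nestedPairs u (2 + g) l)

lefts-nestedPairs : ∀ u g l → map proj₁ (nestedPairs u g l) ↭ range u l
lefts-nestedPairs u g zero    = ↭-refl
lefts-nestedPairs u g (suc l) = begin
  l + u ∷ map proj₁ (nestedPairs u (2 + g) l) ↭⟨ ↭-prep (l + u) (lefts-nestedPairs u (2 + g) l) ⟩
  l + u ∷ range u l                           ↭⟨ ∷↭∷ʳ (l + u) (range u l) ⟩
  range u l ++ [ l + u ]                      ≡⟨ range-suc u l ⟨
  range u (suc l)                             ∎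
  where open PermutationReasoning

rights-nestedPairs : ∀ u g l → map right (nestedPairs u g l) ≡ range (l + u + g) l
rights-nestedPairs u g zero    = refl
rights-nestedPairs u g (suc l) =
  cong₂ _∷_ (first l u g) (trans (rights-nestedPairs u (2 + g) l) (cong (λ b → range b l) (next l u g)))
  where
  first : ∀ l u g → l + u + suc g ≡ suc l + u + g
  first = solve-∀
  next : ∀ l u g → l + u + (2 + g) ≡ suc (suc l + u + g)
  next = solve-∀

-- (u , g , l): l nested pairs whose left ends fill [u, u + l), followed by a gap of g
-- positions and then by their right ends
Run : Set
Run = Lin × Lin × Lin

runPairs : ℕ → Run → List Pair
runPairs x (u , g , l) = nestedPairs (⟦ u ⟧ x) (⟦ g ⟧ x) (⟦ l ⟧ x)

pairsAt : ℕ → List Run → List Pair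
pairsAt x runs = concat (map (runPairs x) runs)

differenceSegment leftSegment rightSegment : Run → Segment
differenceSegment (u , g , l) = sucₗ g , l
leftSegment       (u , g , l) = u , l
rightSegment      (u , g , l) = l ⊕ u ⊕ g , l

segments-++ : ∀ s x σs τs → segments s x (σs ++ τs) ≡ segments s x σs ++ segments s x τs
segments-++ s x σs τs =
  trans (cong concat (List.map-++ (segment s x) σs τs)) (sym (List.concat-++ (map (segment s x) σs) _))

differences-pairsAt : ∀ x runs → differences (pairsAt x runs) ≡ segments 2 x (map differenceSegment runs)
differences-pairsAt x []                    = refl
differences-pairsAt x ((u , g , l) ∷ runs) =
  trans (List.map-++ proj₂ (runPairs x (u , g , l)) (pairsAt x runs))
        (cong₂ _++_ (differences-nestedPairs (⟦ u ⟧ x) (⟦ g ⟧ x) (⟦ l ⟧ x)) (differences-pairsAt x runs))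

lefts-pairsAt : ∀ x runs → map proj₁ (pairsAt x runs) ↭ segments 1 x (map leftSegment runs)
lefts-pairsAt x []                   = ↭-refl
lefts-pairsAt x ((u , g , l) ∷ runs) =
  ↭-trans (↭-reflexive (List.map-++ proj₁ (runPairs x (u , g , l)) (pairsAt x runs)))
          (++⁺ (lefts-nestedPairs (⟦ u ⟧ x) (⟦ g ⟧ x) (⟦ l ⟧ x)) (lefts-pairsAt x runs))

rights-pairsAt : ∀ x runs → map right (pairsAt x runs) ≡ segments 1 x (map rightSegment runs)
rights-pairsAt x []                   = refl
rights-pairsAt x ((u , g , l) ∷ runs) =
  trans (List.map-++ right (runPairs x (u , g , l)) (pairsAt x runs))
        (cong₂ _++_ (trans (rights-nestedPairs (⟦ u ⟧ x) (⟦ g ⟧ x) (⟦ l ⟧ x))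
                           (cong (λ b → range b (⟦ l ⟧ x)) start))
                    (rights-pairsAt x runs))
  where
  start : ⟦ l ⟧ x + ⟦ u ⟧ x + ⟦ g ⟧ x ≡ ⟦ l ⊕ u ⊕ g ⟧ x
  start = sym (trans (⟦⊕⟧ (l ⊕ u) g x) (cong (_+ ⟦ g ⟧ x) (⟦⊕⟧ l u x)))

endSegments : List Run → List Segment
endSegments runs = map leftSegment runs ++ map rightSegment runs

positions-pairsAt : ∀ x runs → positions (pairsAt x runs) ↭ segments 1 x (endSegments runs)
positions-pairsAt x runs =
  ↭-trans (++⁺ (lefts-pairsAt x runs) (↭-reflexive (rights-pairsAt x runs)))
          (↭-reflexive (sym (segments-++ 1 x (map leftSegment runs) (map rightSegment runs))))

differenceTargets : (odd even : Lin) → List Segment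
differenceTargets odd even = (0 x+ 1 , odd) ∷ (0 x+ 2 , even) ∷ []

differences-pairsAt-range : ∀ runs {odd even} → odd ≡ even ⊎ odd ≡ sucₗ even →
  Tiles 2 (differenceTargets odd even) (map differenceSegment runs) →
  ∀ x → differences (pairsAt x runs) ↭ range 1 (⟦ odd ⊕ even ⟧ x)
differences-pairsAt-range runs {odd} {even} halves tiling x = begin
  differences (pairsAt x runs)
    ≡⟨ differences-pairsAt x runs ⟩
  segments 2 x (map differenceSegment runs)
    ↭⟨ tiles⇒↭ 2 (differenceTargets odd even) (map differenceSegment runs) tiling x ⟩
  progression 2 1 (⟦ odd ⟧ x) ++ progression 2 2 (⟦ even ⟧ x) ++ []
    ≡⟨ cong (progression 2 1 (⟦ odd ⟧ x) ++_) (List.++-identityʳ (progression 2 2 (⟦ even ⟧ x))) ⟩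
  progression 2 1 (⟦ odd ⟧ x) ++ progression 2 2 (⟦ even ⟧ x)
    ↭⟨ interleave-halves (⟦ odd ⟧ x) (⟦ even ⟧ x) parity ⟩
  range 1 (⟦ odd ⟧ x + ⟦ even ⟧ x)
    ≡⟨ cong (range 1) (⟦⊕⟧ odd even x) ⟨
  range 1 (⟦ odd ⊕ even ⟧ x) ∎
  where
  open PermutationReasoning
  parity : ⟦ odd ⟧ x ≡ ⟦ even ⟧ x ⊎ ⟦ odd ⟧ x ≡ suc (⟦ even ⟧ x)
  parity = Sum.map (cong (λ f → ⟦ f ⟧ x)) (cong (λ f → ⟦ f ⟧ x)) halves

-- For t = 0 the target is the whole interval [1, 2n]: a tiling never splits a segment,
-- and one may cover both 2n - 1 and 2n.
endTargets : ℕ → Lin → List Segment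
endTargets zero    w = (0 x+ 1 , sucₗ w) ∷ []
endTargets (suc t) w = (0 x+ 1 , w) ∷ (w ⊕ 0 x+ (2 + t) , 0 x+ 1) ∷ []

segments-endTargets : ∀ t w x →
  segments 1 x (endTargets t w) ≡ range 1 (⟦ w ⟧ x) ++ [ suc (⟦ w ⟧ x) + t ]
segments-endTargets zero w x = begin
  range 1 (suc (⟦ w ⟧ x)) ++ []              ≡⟨ List.++-identityʳ _ ⟩
  range 1 (suc (⟦ w ⟧ x))                    ≡⟨ range-suc 1 (⟦ w ⟧ x) ⟩
  range 1 (⟦ w ⟧ x) ++ [ ⟦ w ⟧ x + 1 ]       ≡⟨ cong (λ b → range 1 (⟦ w ⟧ x) ++ [ b ]) last ⟩
  range 1 (⟦ w ⟧ x) ++ [ suc (⟦ w ⟧ x) + 0 ] ∎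
  where
  open ≡-Reasoning
  last : ⟦ w ⟧ x + 1 ≡ suc (⟦ w ⟧ x) + 0
  last = trans (+-comm (⟦ w ⟧ x) 1) (sym (+-identityʳ _))
segments-endTargets (suc t) w x =
  cong (λ b → range 1 (⟦ w ⟧ x) ++ [ b ]) (trans (⟦⊕⟧ w (0 x+ (2 + t)) x) (shuffle (⟦ w ⟧ x) t))
  where
  shuffle : ∀ m t → m + (2 + t + 0) ≡ suc m + suc t
  shuffle = solve-∀

positions-pairsAt-range : ∀ t runs w → Tiles 1 (endTargets t w) (endSegments runs) →
  ∀ x → positions (pairsAt x runs) ↭ range 1 (⟦ w ⟧ x) ++ [ suc (⟦ w ⟧ x) + t ]
positions-pairsAt-range t runs w tiling x = begin
  positions (pairsAt x runs)       ↭⟨ positions-pairsAt x runs ⟩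
  segments 1 x (endSegments runs)  ↭⟨ tiles⇒↭ 1 (endTargets t w) (endSegments runs) tiling x ⟩
  segments 1 x (endTargets t w)    ≡⟨ segments-endTargets t w x ⟩
  range 1 (⟦ w ⟧ x) ++ [ suc (⟦ w ⟧ x) + t ] ∎
  where open PermutationReasoning

pairsAt-isSkolemSequence : ∀ t (runs : List Run) (n odd even w : Lin) →
  n ≡ odd ⊕ even → odd ≡ even ⊎ odd ≡ sucₗ even → sucₗ w ≡ 2 ⊛ n →
  Tiles 2 (differenceTargets odd even) (map differenceSegment runs) →
  Tiles 1 (endTargets t w) (endSegments runs) →
  ∀ x → IsSkolemSequence (⟦ n ⟧ x) t (pairsAt x runs)
pairsAt-isSkolemSequence t runs n odd even w refl halves w+1≡2n differences-tiling positions-tiling x =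
  differences-pairsAt-range runs halves differences-tiling x ,
  subst (λ m → positions (pairsAt x runs) ↭ range 1 (m ∸ 1) ++ [ m + t ]) w+1≡2n′
        (positions-pairsAt-range t runs w positions-tiling x)
  where
  w+1≡2n′ : suc (⟦ w ⟧ x) ≡ 2 * ⟦ n ⟧ x
  w+1≡2n′ = trans (cong (λ f → ⟦ f ⟧ x) w+1≡2n) (⟦⊛⟧ 2 n x)

-- From Skolem sequences to Skolem systems

unique-resp-↭ : ∀ {B : Set} {xs ys : List B} → xs ↭ ys → Unique xs → Unique ys
unique-resp-↭ {B} p = Permutationₛ.Unique-resp-↭ (setoid B) (↭⇒↭ₛ p)

module _ {A B : Set} (g : A → List B) where

  ∈-concat-lookup⁺ : ∀ xs i {x} → x ∈ g (lookup xs i) → x ∈ concat (map g xs)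
  ∈-concat-lookup⁺ xs i x∈ = ∈-concat⁺′ x∈ (∈-map⁺ g (∈-lookup {xs = xs} i))

  ∈-concat-lookup⁻ : ∀ xs {x} → x ∈ concat (map g xs) → ∃ λ i → x ∈ g (lookup xs i)
  ∈-concat-lookup⁻ xs {x} x∈ = Any.index x∈g , Any.lookup-index {xs = xs} x∈g
    where
    x∈g : Any.Any (λ a → x ∈ g a) xs
    x∈g = Any.map⁻ {xs = xs} (∈-concat⁻ (map g xs) x∈)

  private
    unique-++-disjoint : ∀ xs {ys} {v : B} → Unique (xs ++ ys) → v ∈ xs → v ∈ ys → ⊥
    unique-++-disjoint (x ∷ xs) (x∉ ∷ _) (here refl) v∈ys = All.lookup (All.++⁻ʳ xs x∉) v∈ys refl
    unique-++-disjoint (x ∷ xs) (_ ∷ u)  (there v∈)  v∈ys = unique-++-disjoint xs u v∈ v∈ys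

    unique-++ʳ : ∀ (xs : List B) {ys} → Unique (xs ++ ys) → Unique ys
    unique-++ʳ []       u       = u
    unique-++ʳ (x ∷ xs) (_ ∷ u) = unique-++ʳ xs u

  concat-lookup-unique : ∀ xs i j {x} → Unique (concat (map g xs)) →
    x ∈ g (lookup xs i) → x ∈ g (lookup xs j) → i ≡ j
  concat-lookup-unique (a ∷ xs) zero    zero    u p q = refl
  concat-lookup-unique (a ∷ xs) zero    (suc j) u p q = ⊥-elim (unique-++-disjoint (g a) u p (∈-concat-lookup⁺ xs j q))
  concat-lookup-unique (a ∷ xs) (suc i) zero    u p q = ⊥-elim (unique-++-disjoint (g a) u q (∈-concat-lookup⁺ xs i p))
  concat-lookup-unique (a ∷ xs) (suc i) (suc j) u p q = cong suc (concat-lookup-unique xs i j (unique-++ʳ (g a) u) p q)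

partition-from-↭ : ∀ {A : Set} (f : A → List ℤ) xs {E P} →
  concat (map (absList ∘ f) xs) ↭ E → Unique E → (∀ {x} → x ∈ E → P x) → (∀ {x} → P x → x ∈ E) →
  IsPartitionOf (λ i → f (lookup xs i)) P
partition-from-↭ f xs flat↭E E! E⊆P P⊆E =
  (λ i x x∈ → E⊆P (∈-resp-↭ flat↭E (∈-concat-lookup⁺ (absList ∘ f) xs i x∈))) ,
  (λ x Px → ∈-concat-lookup⁻ (absList ∘ f) xs (∈-resp-↭ (↭-sym flat↭E) (P⊆E Px))) ,
  (λ i j x p q → concat-lookup-unique (absList ∘ f) xs i j (unique-resp-↭ (↭-sym flat↭E) E!) p q)

targets : (n k t : ℕ) → List ℕ
targets n k t = range 1 n ++ range (n + 1 + k) (2 * n ∸ 1) ++ [ 3 * n + k + t ]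

private
  -- solve-∀ does not see through ∸, but for suc n both subtractions compute away.
  middle-end : ∀ n k → suc n + 1 + k + (2 * suc n ∸ 1) ≡ suc (3 * suc n + k ∸ 1)
  middle-end = reduced
    where
    reduced : ∀ n k → suc n + 1 + k + (n + (suc n + 0)) ≡ suc (n + (suc n + (suc n + 0)) + k)
    reduced = solve-∀

  hook-above : ∀ n k t → suc n + 1 + k ≤ 3 * suc n + k + t
  hook-above n k t = subst (suc n + 1 + k ≤_) (shuffle n k t) (m≤m+n (suc n + 1 + k) (n + suc (n + t)))
    where
    shuffle : ∀ n k t → suc n + 1 + k + (n + suc (n + t)) ≡ 3 * suc n + k + t
    shuffle = solve-∀

∈-targets⁻ : ∀ n k t {x} → x ∈ targets (suc n) k t → InTarget (3 * suc n) k t (suc n) x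
∈-targets⁻ n k t {x} x∈ with ∈-++⁻ (range 1 (suc n)) x∈
... | inj₁ x∈low = inj₁ (proj₁ (∈-range⁻ 1 (suc n) x∈low) , ≤-pred (proj₂ (∈-range⁻ 1 (suc n) x∈low)))
... | inj₂ x∈high with ∈-++⁻ (range (suc n + 1 + k) (2 * suc n ∸ 1)) x∈high
...   | inj₁ x∈mid = let lo , x<end = ∈-range⁻ (suc n + 1 + k) (2 * suc n ∸ 1) x∈mid in
                     inj₂ (inj₁ (lo , ≤-pred (subst (x <_) (middle-end n k) x<end)))
...   | inj₂ (here refl) = inj₂ (inj₂ refl)

∈-targets⁺ : ∀ n k t {x} → InTarget (3 * suc n) k t (suc n) x → x ∈ targets (suc n) k t
∈-targets⁺ n k t (inj₁ (1≤x , x≤n)) = ∈-++⁺ˡ (∈-range⁺ 1 (suc n) 1≤x (s≤s x≤n))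
∈-targets⁺ n k t {x} (inj₂ (inj₁ (lo , hi))) =
  ∈-++⁺ʳ (range 1 (suc n))
    (∈-++⁺ˡ (∈-range⁺ (suc n + 1 + k) (2 * suc n ∸ 1) lo (subst (x <_) (sym (middle-end n k)) (s≤s hi))))
∈-targets⁺ n k t (inj₂ (inj₂ refl)) =
  ∈-++⁺ʳ (range 1 (suc n)) (∈-++⁺ʳ (range (suc n + 1 + k) (2 * suc n ∸ 1)) (here refl))

targets-unique : ∀ n k t → Unique (targets (suc n) k t)
targets-unique n k t =
  range-++-unique 1 (suc n) (All.tabulate above-low)
    (range-++-unique (suc n + 1 + k) (2 * suc n ∸ 1)
      (subst (_≤ 3 * suc n + k + t) (sym (middle-end n k)) (m≤m+n (3 * suc n + k) t) All.∷ All.[])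
      (All.[] ∷ []))
  where
  low-end : 1 + suc n ≤ suc n + 1 + k
  low-end = ≤-trans (≤-reflexive (+-comm 1 (suc n))) (m≤m+n (suc n + 1) k)
  above-low : ∀ {y} → y ∈ range (suc n + 1 + k) (2 * suc n ∸ 1) ++ [ 3 * suc n + k + t ] → 1 + suc n ≤ y
  above-low y∈ with ∈-++⁻ (range (suc n + 1 + k) (2 * suc n ∸ 1)) y∈
  ... | inj₁ y∈mid       = ≤-trans low-end (proj₁ (∈-range⁻ (suc n + 1 + k) (2 * suc n ∸ 1) y∈mid))
  ... | inj₂ (here refl) = ≤-trans low-end (hook-above n k t)

negateIf : Bool → ℤ → ℤ
negateIf false i = i
negateIf true  i = - i

triple : ℕ → Pair → List ℤ
triple K (p , d) = + d ∷ + (K + p) ∷ - + (K + (p + d)) ∷ []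

-- the sign of a triple, which of its entries is picked, and the pair it comes from
Marked : Set
Marked = Bool × Fin 3 × Pair

pair : Marked → Pair
pair (_ , _ , pr) = pr

signedTriple : ℕ → Marked → List ℤ
signedTriple K (σ , _ , pr) = map (negateIf σ) (triple K pr)

picked : ℕ → Marked → ℤ
picked K (σ , j , pr) = negateIf σ (lookup (triple K pr) j)

picked∈signedTriple : ∀ K m → picked K m ∈ signedTriple K m
picked∈signedTriple K (σ , j , pr) = ∈-map⁺ (negateIf σ) (∈-lookup {xs = triple K pr} j)

absList-negateIf : ∀ σ xs → absList (map (negateIf σ) xs) ≡ absList xs
absList-negateIf σ       []       = refl
absList-negateIf false   (x ∷ xs) = cong (∣ x ∣ ∷_) (absList-negateIf false xs)
absList-negateIf true    (x ∷ xs) = cong₂ _∷_ (ℤ.∣-i∣≡∣i∣ x) (absList-negateIf true xs)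

negateIf-+ : ∀ σ i j → negateIf σ (i ℤ.+ j) ≡ negateIf σ i ℤ.+ negateIf σ j
negateIf-+ false i j = refl
negateIf-+ true  i j = ℤ.neg-distrib-+ i j

sumℤ-negateIf : ∀ σ xs → sumℤ (map (negateIf σ) xs) ≡ negateIf σ (sumℤ xs)
sumℤ-negateIf false []       = refl
sumℤ-negateIf true  []       = refl
sumℤ-negateIf σ     (x ∷ xs) =
  trans (cong (λ s → negateIf σ x ℤ.+ s) (sumℤ-negateIf σ xs)) (sym (negateIf-+ σ x (sumℤ xs)))

sum-triple : ∀ K p d → sumℤ (triple K (p , d)) ≡ 0ℤ
sum-triple K p d = begin
  + d ℤ.+ (+ (K + p) ℤ.+ (- + (K + (p + d)) ℤ.+ 0ℤ))
    ≡⟨ cong₂ (λ a b → + d ℤ.+ (a ℤ.+ (- b ℤ.+ 0ℤ))) (ℤ.pos-+ K p)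
             (trans (ℤ.pos-+ K (p + d)) (cong (λ s → + K ℤ.+ s) (ℤ.pos-+ p d))) ⟩
  + d ℤ.+ ((+ K ℤ.+ + p) ℤ.+ (- (+ K ℤ.+ (+ p ℤ.+ + d)) ℤ.+ 0ℤ))
    ≡⟨ cancel (+ K) (+ p) (+ d) ⟩
  0ℤ ∎
  where
  open ≡-Reasoning
  cancel : ∀ k p d → d ℤ.+ ((k ℤ.+ p) ℤ.+ (- (k ℤ.+ (p ℤ.+ d)) ℤ.+ 0ℤ)) ≡ 0ℤ
  cancel = ℤ-Solver.solve-∀

sum-signedTriple : ∀ K m → sumℤ (signedTriple K m) ≡ 0ℤ
sum-signedTriple K (σ , _ , p , d) =
  trans (sumℤ-negateIf σ (triple K (p , d))) (trans (cong (negateIf σ) (sum-triple K p d)) (negateIf-0 σ))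
  where
  negateIf-0 : ∀ σ → negateIf σ 0ℤ ≡ 0ℤ
  negateIf-0 false = refl
  negateIf-0 true  = refl

absList-triples : ∀ K (ms : List Marked) → let ps = map pair ms in
  concat (map (absList ∘ signedTriple K) ms) ↭ differences ps ++ map (_+_ K) (positions ps)
absList-triples K []                       = ↭-refl
absList-triples K (m@(σ , j , p , d) ∷ ms) = begin
  absList (signedTriple K m) ++ concat (map (absList ∘ signedTriple K) ms)
    ≡⟨ cong (_++ concat (map (absList ∘ signedTriple K) ms)) (absList-negateIf σ (triple K (p , d))) ⟩
  d ∷ K + p ∷ ∣ - + (K + (p + d)) ∣ ∷ concat (map (absList ∘ signedTriple K) ms)
    ↭⟨ ↭-prep d (↭-prep (K + p) (↭-prep _ (absList-triples K ms))) ⟩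
  d ∷ K + p ∷ ∣ - + (K + (p + d)) ∣ ∷ (D ++ map (_+_ K) (L ++ R))
    ≡⟨ cong₂ (λ a rest → d ∷ K + p ∷ a ∷ rest) (ℤ.∣-i∣≡∣i∣ (+ (K + (p + d))))
             (trans (cong (D ++_) (List.map-++ (_+_ K) L R)) (sym (List.++-assoc D (map (_+_ K) L) (map (_+_ K) R)))) ⟩
  d ∷ K + p ∷ K + (p + d) ∷ ((D ++ map (_+_ K) L) ++ map (_+_ K) R)
    ↭⟨ ↭-prep d (↭-prep (K + p) (↭-sym (shift (K + (p + d)) (D ++ map (_+_ K) L) (map (_+_ K) R)))) ⟩
  d ∷ K + p ∷ ((D ++ map (_+_ K) L) ++ K + (p + d) ∷ map (_+_ K) R)
    ≡⟨ cong (λ rest → d ∷ K + p ∷ rest) (List.++-assoc D (map (_+_ K) L) _) ⟩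
  d ∷ K + p ∷ (D ++ map (_+_ K) L ++ K + (p + d) ∷ map (_+_ K) R)
    ↭⟨ ↭-prep d (↭-sym (shift (K + p) D _)) ⟩
  d ∷ D ++ K + p ∷ map (_+_ K) L ++ K + (p + d) ∷ map (_+_ K) R
    ≡⟨ cong (λ rest → d ∷ D ++ K + p ∷ rest) (List.map-++ (_+_ K) L (p + d ∷ R)) ⟨
  d ∷ D ++ map (_+_ K) ((p ∷ L) ++ p + d ∷ R) ∎
  where
  open PermutationReasoning
  D L R : List ℕ
  D = differences (map pair ms)
  L = map proj₁ (map pair ms)
  R = map right (map pair ms)

ZeroSumSkolemSystem : (n k t : ℕ) → Set
ZeroSumSkolemSystem n k t = ∃ λ (D : Fin n → List ℤ) → Is3SkolemSystem n k t D × IsZeroSum D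

skolemSequence-length : ∀ {n t ps} → IsSkolemSequence n t ps → length ps ≡ n
skolemSequence-length {n} {ps = ps} (differences↭ , _) =
  trans (sym (List.length-map proj₂ ps)) (trans (↭-length differences↭) (length-progression 1 1 n))

sumFinℕ-const : ∀ n c → sumFinℕ {n} (λ _ → c) ≡ c * n
sumFinℕ-const zero    c = sym (*-zeroʳ c)
sumFinℕ-const (suc n) c = trans (cong (_+_ c) (sumFinℕ-const n c)) (sym (*-suc c n))

sumFinℤ-lookup : ∀ {A : Set} (f : A → ℤ) xs → sumFinℤ (λ i → f (lookup xs i)) ≡ sumℤ (map f xs)
sumFinℤ-lookup f []       = refl
sumFinℤ-lookup f (x ∷ xs) = cong (λ s → f x ℤ.+ s) (sumFinℤ-lookup f xs)

shifted-positions : ∀ n k t →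
  map (_+_ (n + k)) (range 1 (2 * n ∸ 1) ++ [ 2 * n + t ]) ≡ range (n + 1 + k) (2 * n ∸ 1) ++ [ 3 * n + k + t ]
shifted-positions n k t =
  trans (List.map-++ (_+_ (n + k)) (range 1 (2 * n ∸ 1)) [ 2 * n + t ])
        (cong₂ _++_ (trans (map-+-progression (n + k) 1 1 (2 * n ∸ 1)) (cong (λ a → range a (2 * n ∸ 1)) (start n k)))
                    (cong [_] (hook n k t)))
  where
  start : ∀ n k → n + k + 1 ≡ n + 1 + k
  start = solve-∀
  hook : ∀ n k t → n + k + (2 * n + t) ≡ 3 * n + k + t
  hook = solve-∀

private
  zeroSumSkolemSystem′ : ∀ k t n (ms : List Marked) → length ms ≡ n → 1 ≤ n →
    IsSkolemSequence n t (map pair ms) → sumℤ (map (picked (n + k)) ms) ≡ 0ℤ →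
    ZeroSumSkolemSystem n k t
  zeroSumSkolemSystem′ k t .0 [] refl () _ _
  zeroSumSkolemSystem′ k t .(length (m ∷ ms)) (m ∷ ms) refl _ (differences↭ , positions↭) zero-sum =
    D , ((λ _ → ≤-refl) , (λ _ → refl) , (λ i → sum-signedTriple K (lookup ms′ i)) ,
         (n , s≤s z≤n , subst (λ M → IsPartitionOf D (InTarget M k t n)) (sym (sumFinℕ-const n 3)) partition)) ,
        ((λ i → picked K (lookup ms′ i)) , (λ i → picked∈signedTriple K (lookup ms′ i)) ,
         trans (sumFinℤ-lookup (picked K) ms′) zero-sum)
    where
    ms′ : List Marked
    ms′ = m ∷ ms
    n K : ℕ
    n = length ms′
    K = n + k
    D : Fin n → List ℤ
    D i = signedTriple K (lookup ms′ i)
    flat↭targets : concat (map (absList ∘ signedTriple K) ms′) ↭ targets n k t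
    flat↭targets = ↭-trans (absList-triples K ms′)
      (↭-trans (++⁺ differences↭ (map⁺ (_+_ K) positions↭))
               (↭-reflexive (cong (range 1 n ++_) (shifted-positions n k t))))
    partition : IsPartitionOf D (InTarget (3 * n) k t n)
    partition = partition-from-↭ (signedTriple K) ms′ flat↭targets (targets-unique (length ms) k t)
                  (∈-targets⁻ (length ms) k t) (∈-targets⁺ (length ms) k t)

zeroSumSkolemSystem : ∀ k t n (ms : List Marked) → 1 ≤ n →
  IsSkolemSequence n t (map pair ms) → sumℤ (map (picked (n + k)) ms) ≡ 0ℤ → ZeroSumSkolemSystem n k t
zeroSumSkolemSystem k t n ms n≥1 skolem zero-sum =
  zeroSumSkolemSystem′ k t n ms (trans (sym (List.length-map pair ms)) (skolemSequence-length skolem))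
    n≥1 skolem zero-sum

-- Signs

signed : (ℕ → Bool) → ℕ → ℤ
signed σ d = negateIf (σ d) (+ d)

signedSum : (ℕ → Bool) → List ℕ → ℤ
signedSum σ ds = sumℤ (map (signed σ) ds)

sumℤ-++ : ∀ xs ys → sumℤ (xs ++ ys) ≡ sumℤ xs ℤ.+ sumℤ ys
sumℤ-++ []       ys = sym (ℤ.+-identityˡ (sumℤ ys))
sumℤ-++ (x ∷ xs) ys = trans (cong (λ s → x ℤ.+ s) (sumℤ-++ xs ys)) (sym (ℤ.+-assoc x (sumℤ xs) (sumℤ ys)))

sumℤ-↭ : ∀ {xs ys} → xs ↭ ys → sumℤ xs ≡ sumℤ ys
sumℤ-↭ p = Permutationₛ.foldr-commMonoid (setoid ℤ) ℤ.+-0-isCommutativeMonoid (↭⇒↭ₛ p)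

signedSum-++ : ∀ σ xs ys → signedSum σ (xs ++ ys) ≡ signedSum σ xs ℤ.+ signedSum σ ys
signedSum-++ σ xs ys = trans (cong sumℤ (List.map-++ (signed σ) xs ys)) (sumℤ-++ (map (signed σ) xs) (map (signed σ) ys))

signedSum-not : ∀ σ ds → signedSum (not ∘ σ) ds ≡ - signedSum σ ds
signedSum-not σ []       = refl
signedSum-not σ (d ∷ ds) =
  trans (cong₂ ℤ._+_ (signed-not (σ d)) (signedSum-not σ ds)) (sym (ℤ.neg-distrib-+ (signed σ d) (signedSum σ ds)))
  where
  signed-not : ∀ b → negateIf (not b) (+ d) ≡ - negateIf b (+ d)
  signed-not true  = sym (ℤ.neg-involutive (+ d))
  signed-not false = refl

-- the sign of ±d, as a function of d mod 4 (true: negative)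
signPattern : (s₀ s₁ s₂ s₃ : Bool) → ℕ → Bool
signPattern s₀ s₁ s₂ s₃ 0                             = s₀
signPattern s₀ s₁ s₂ s₃ 1                             = s₁
signPattern s₀ s₁ s₂ s₃ 2                             = s₂
signPattern s₀ s₁ s₂ s₃ 3                             = s₃
signPattern s₀ s₁ s₂ s₃ (suc (suc (suc (suc d)))) = signPattern s₀ s₁ s₂ s₃ d

signPattern-periodic : ∀ {s₀ s₁ s₂ s₃} i j →
  signPattern s₀ s₁ s₂ s₃ (i + j * 4) ≡ signPattern s₀ s₁ s₂ s₃ i
signPattern-periodic {s₀} {s₁} {s₂} {s₃} i zero    = cong (signPattern s₀ s₁ s₂ s₃) (+-identityʳ i)
signPattern-periodic {s₀} {s₁} {s₂} {s₃} i (suc j) =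
  trans (cong (signPattern s₀ s₁ s₂ s₃) (shuffle i j)) (signPattern-periodic i j)
  where
  shuffle : ∀ i j → i + suc j * 4 ≡ 4 + (i + j * 4)
  shuffle = solve-∀

blocks-vanish : ∀ σ c → (∀ j → signedSum σ (range (c + j * 4) 4) ≡ 0ℤ) →
  ∀ j m → signedSum σ (range (c + j * 4) (m * 4)) ≡ 0ℤ
blocks-vanish σ c block j zero    = refl
blocks-vanish σ c block j (suc m) = begin
  signedSum σ (range (c + j * 4) 4 ++ range (4 + (c + j * 4)) (m * 4))
    ≡⟨ signedSum-++ σ (range (c + j * 4) 4) (range (4 + (c + j * 4)) (m * 4)) ⟩
  signedSum σ (range (c + j * 4) 4) ℤ.+ signedSum σ (range (4 + (c + j * 4)) (m * 4))
    ≡⟨ cong₂ ℤ._+_ (block j) (trans (cong (λ a → signedSum σ (range a (m * 4))) (next c j))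
                                    (blocks-vanish σ c block (suc j) m)) ⟩
  0ℤ ∎
  where
  open ≡-Reasoning
  next : ∀ c j → 4 + (c + j * 4) ≡ c + suc j * 4
  next = solve-∀

signs₀ signs₁ signs₂ signs₃ : ℕ → Bool
signs₀ = signPattern true true false false
signs₁ = not ∘ signs₀
signs₂ = not ∘ signs₃
signs₃ = signPattern false true true false

block₀ : ∀ j → signedSum signs₀ (range (1 + j * 4) 4) ≡ 0ℤ
block₀ j rewrite signPattern-periodic {true} {true} {false} {false} 1 j
               | signPattern-periodic {true} {true} {false} {false} 2 j
               | signPattern-periodic {true} {true} {false} {false} 3 j
               | signPattern-periodic {true} {true} {false} {false} 4 j
               | ℤ.pos-+ 1 (j * 4) | ℤ.pos-+ 2 (j * 4) | ℤ.pos-+ 3 (j * 4) | ℤ.pos-+ 4 (j * 4) = cancel (+ (j * 4))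
  where
  cancel : ∀ y → - (+ 1 ℤ.+ y) ℤ.+ ((+ 2 ℤ.+ y) ℤ.+ ((+ 3 ℤ.+ y) ℤ.+ (- (+ 4 ℤ.+ y) ℤ.+ 0ℤ))) ≡ 0ℤ
  cancel = ℤ-Solver.solve-∀

block₃ : ∀ j → signedSum signs₃ (range (0 + j * 4) 4) ≡ 0ℤ
block₃ j rewrite signPattern-periodic {false} {true} {true} {false} 0 j
               | signPattern-periodic {false} {true} {true} {false} 1 j
               | signPattern-periodic {false} {true} {true} {false} 2 j
               | signPattern-periodic {false} {true} {true} {false} 3 j
               | ℤ.pos-+ 1 (j * 4) | ℤ.pos-+ 2 (j * 4) | ℤ.pos-+ 3 (j * 4) = cancel (+ (j * 4))
  where
  cancel : ∀ y → y ℤ.+ (- (+ 1 ℤ.+ y) ℤ.+ (- (+ 2 ℤ.+ y) ℤ.+ ((+ 3 ℤ.+ y) ℤ.+ 0ℤ))) ≡ 0ℤ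
  cancel = ℤ-Solver.solve-∀

signedSum-signs₀ : ∀ m → signedSum signs₀ (range 1 (m * 4)) ≡ 0ℤ
signedSum-signs₀ = blocks-vanish signs₀ 1 block₀ 0

signedSum-signs₃ : ∀ m → signedSum signs₃ (range 1 (3 + m * 4)) ≡ 0ℤ
signedSum-signs₃ m = trans (sym (ℤ.+-identityˡ _)) (blocks-vanish signs₃ 0 block₃ 0 (suc m))

signedSum-signs₁ : ∀ m → signedSum signs₁ (range 1 (1 + m * 4)) ≡ + (1 + m * 4)
signedSum-signs₁ m = begin
  signedSum signs₁ (range 1 (1 + m * 4))
    ≡⟨ signedSum-not signs₀ (range 1 (1 + m * 4)) ⟩
  - signedSum signs₀ (range 1 (1 + m * 4))
    ≡⟨ cong (λ l → - signedSum signs₀ (range 1 l)) (+-comm 1 (m * 4)) ⟩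
  - signedSum signs₀ (range 1 (m * 4 + 1))
    ≡⟨ cong (λ ds → - signedSum signs₀ ds) (range-++ 1 (m * 4) 1) ⟩
  - signedSum signs₀ (range 1 (m * 4) ++ [ 1 + m * 4 ])
    ≡⟨ cong -_ (signedSum-++ signs₀ (range 1 (m * 4)) [ 1 + m * 4 ]) ⟩
  - (signedSum signs₀ (range 1 (m * 4)) ℤ.+ (signed signs₀ (1 + m * 4) ℤ.+ 0ℤ))
    ≡⟨ cong₂ (λ a b → - (a ℤ.+ (negateIf b (+ (1 + m * 4)) ℤ.+ 0ℤ)))
             (signedSum-signs₀ m) (signPattern-periodic 1 m) ⟩
  - (0ℤ ℤ.+ (- + (1 + m * 4) ℤ.+ 0ℤ))
    ≡⟨ cancel (+ (1 + m * 4)) ⟩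
  + (1 + m * 4) ∎
  where
  open ≡-Reasoning
  cancel : ∀ a → - (0ℤ ℤ.+ (- a ℤ.+ 0ℤ)) ≡ a
  cancel = ℤ-Solver.solve-∀

tail₃ : ∀ m → signedSum signs₃ (range (m * 4) 3) ≡ - + (3 + m * 4)
tail₃ m rewrite signPattern-periodic {false} {true} {true} {false} 0 m
              | signPattern-periodic {false} {true} {true} {false} 1 m
              | signPattern-periodic {false} {true} {true} {false} 2 m
              | ℤ.pos-+ 1 (m * 4) | ℤ.pos-+ 2 (m * 4) | ℤ.pos-+ 3 (m * 4) = collect (+ (m * 4))
  where
  collect : ∀ y → y ℤ.+ (- (+ 1 ℤ.+ y) ℤ.+ (- (+ 2 ℤ.+ y) ℤ.+ 0ℤ)) ≡ - (+ 3 ℤ.+ y)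
  collect = ℤ-Solver.solve-∀

signedSum-signs₂ : ∀ m → signedSum signs₂ (range 1 (2 + m * 4)) ≡ + (3 + m * 4)
signedSum-signs₂ m = begin
  signedSum signs₂ (range 1 (2 + m * 4))
    ≡⟨ signedSum-not signs₃ (range 1 (2 + m * 4)) ⟩
  - signedSum signs₃ (range 1 (2 + m * 4))
    ≡⟨ cong -_ (ℤ.+-identityˡ _) ⟨
  - signedSum signs₃ (range 0 (3 + m * 4))
    ≡⟨ cong (λ l → - signedSum signs₃ (range 0 l)) (+-comm 3 (m * 4)) ⟩
  - signedSum signs₃ (range 0 (m * 4 + 3))
    ≡⟨ cong (λ ds → - signedSum signs₃ ds) (range-++ 0 (m * 4) 3) ⟩
  - signedSum signs₃ (range 0 (m * 4) ++ range (m * 4) 3)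
    ≡⟨ cong -_ (signedSum-++ signs₃ (range 0 (m * 4)) (range (m * 4) 3)) ⟩
  - (signedSum signs₃ (range 0 (m * 4)) ℤ.+ signedSum signs₃ (range (m * 4) 3))
    ≡⟨ cong₂ (λ a b → - (a ℤ.+ b)) (blocks-vanish signs₃ 0 block₃ 0 m) (tail₃ m) ⟩
  - (0ℤ ℤ.+ - + (3 + m * 4))
    ≡⟨ cancel (+ (3 + m * 4)) ⟩
  + (3 + m * 4) ∎
  where
  open ≡-Reasoning
  cancel : ∀ a → - (0ℤ ℤ.+ - a) ≡ a
  cancel = ℤ-Solver.solve-∀

marked : (ℕ → Bool) → Pair → Marked
marked σ (p , d) = σ d , zero , p , d

pair-marked : ∀ σ ps → map pair (map (marked σ) ps) ≡ ps
pair-marked σ []            = refl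
pair-marked σ ((p , d) ∷ ps) = cong ((p , d) ∷_) (pair-marked σ ps)

picked-marked : ∀ K σ ps → sumℤ (map (picked K) (map (marked σ) ps)) ≡ signedSum σ (differences ps)
picked-marked K σ []             = refl
picked-marked K σ ((p , d) ∷ ps) = cong (λ s → signed σ d ℤ.+ s) (picked-marked K σ ps)

zeroSum-signed : ∀ k t n σ ps → 1 ≤ n → IsSkolemSequence n t ps → signedSum σ (range 1 n) ≡ 0ℤ →
  ZeroSumSkolemSystem n k t
zeroSum-signed k t n σ ps n≥1 skolem balanced =
  zeroSumSkolemSystem k t n (map (marked σ) ps) n≥1 (subst (IsSkolemSequence n t) (sym (pair-marked σ ps)) skolem)
    (trans (picked-marked (n + k) σ ps) (trans (sumℤ-↭ (map⁺ (signed σ) (proj₁ skolem))) balanced))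

exceptional-sum : ∀ K pA dA pB dB N R → + dA ℤ.+ (- + dB ℤ.+ R) ≡ + N → pB + N + dB ≡ pA + dA + dA →
  - + (K + (pA + dA)) ℤ.+ (+ (K + pB) ℤ.+ R) ≡ 0ℤ
exceptional-sum K pA dA pB dB N R signed≡N balance = begin
  - + (K + (pA + dA)) ℤ.+ (+ (K + pB) ℤ.+ R)
    ≡⟨ cong₂ (λ a b → - a ℤ.+ (b ℤ.+ R))
             (trans (ℤ.pos-+ K (pA + dA)) (cong (λ s → + K ℤ.+ s) (ℤ.pos-+ pA dA))) (ℤ.pos-+ K pB) ⟩
  - (+ K ℤ.+ (+ pA ℤ.+ + dA)) ℤ.+ ((+ K ℤ.+ + pB) ℤ.+ R)
    ≡⟨ regroup (+ K) (+ pA) (+ dA) (+ pB) (+ dB) R ⟩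
  (+ pB ℤ.+ (+ dA ℤ.+ (- + dB ℤ.+ R)) ℤ.+ + dB) ℤ.- (+ pA ℤ.+ + dA ℤ.+ + dA)
    ≡⟨ cong (λ s → (+ pB ℤ.+ s ℤ.+ + dB) ℤ.- (+ pA ℤ.+ + dA ℤ.+ + dA)) signed≡N ⟩
  (+ pB ℤ.+ + N ℤ.+ + dB) ℤ.- (+ pA ℤ.+ + dA ℤ.+ + dA)
    ≡⟨ cong₂ ℤ._-_ (pos-+₃ pB N dB) (pos-+₃ pA dA dA) ⟨
  + (pB + N + dB) ℤ.- + (pA + dA + dA)
    ≡⟨ cong (λ s → + (pB + N + dB) ℤ.- + s) balance ⟨
  + (pB + N + dB) ℤ.- + (pB + N + dB)
    ≡⟨ ℤ.+-inverseʳ (+ (pB + N + dB)) ⟩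
  0ℤ ∎
  where
  open ≡-Reasoning
  regroup : ∀ k a d b e r →
    - (k ℤ.+ (a ℤ.+ d)) ℤ.+ ((k ℤ.+ b) ℤ.+ r) ≡ (b ℤ.+ (d ℤ.+ (- e ℤ.+ r)) ℤ.+ e) ℤ.- (a ℤ.+ d ℤ.+ d)
  regroup = ℤ-Solver.solve-∀
  pos-+₃ : ∀ a b c → + (a + b + c) ≡ + a ℤ.+ + b ℤ.+ + c
  pos-+₃ a b c = trans (ℤ.pos-+ (a + b) c) (cong (ℤ._+ + c) (ℤ.pos-+ a b))

-- Picking -(K + pA + dA) and K + pB instead of ±dA and ±dB, the K's cancel and the signed
-- sum N of all differences is compensated.
zeroSum-exceptional : ∀ k t n σ N pA dA pB dB ps → 1 ≤ n →
  IsSkolemSequence n t ((pA , dA) ∷ (pB , dB) ∷ ps) → signedSum σ (range 1 n) ≡ + N →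
  σ dA ≡ false → σ dB ≡ true → pB + N + dB ≡ pA + dA + dA → ZeroSumSkolemSystem n k t
zeroSum-exceptional k t n σ N pA dA pB dB ps n≥1 skolem signed≡N σA σB balance =
  zeroSumSkolemSystem k t n ((false , # 2 , pA , dA) ∷ (false , # 1 , pB , dB) ∷ map (marked σ) ps) n≥1
    (subst (λ qs → IsSkolemSequence n t ((pA , dA) ∷ (pB , dB) ∷ qs)) (sym (pair-marked σ ps)) skolem)
    (trans (cong (λ s → - + (n + k + (pA + dA)) ℤ.+ (+ (n + k + pB) ℤ.+ s)) (picked-marked (n + k) σ ps))
           (exceptional-sum (n + k) pA dA pB dB N (signedSum σ (differences ps)) differences≡N balance))
  where
  differences≡N : + dA ℤ.+ (- + dB ℤ.+ signedSum σ (differences ps)) ≡ + N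
  differences≡N = begin
    + dA ℤ.+ (- + dB ℤ.+ signedSum σ (differences ps))
      ≡⟨ cong₂ (λ a b → negateIf a (+ dA) ℤ.+ (negateIf b (+ dB) ℤ.+ signedSum σ (differences ps))) σA σB ⟨
    signedSum σ (dA ∷ dB ∷ differences ps)
      ≡⟨ sumℤ-↭ (map⁺ (signed σ) (proj₁ skolem)) ⟩
    signedSum σ (range 1 n)
      ≡⟨ signed≡N ⟩
    + N ∎
    where open ≡-Reasoning

pairRun : Pair → Run
pairRun (p , d) = 0 x+ p , 0 x+ (d ∸ 1) , 0 x+ 1

signPattern-+4* : ∀ {s₀ s₁ s₂ s₃} i x →
  signPattern s₀ s₁ s₂ s₃ (i + 4 * x) ≡ signPattern s₀ s₁ s₂ s₃ i
signPattern-+4* {s₀} {s₁} {s₂} {s₃} i x =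
  trans (cong (λ y → signPattern s₀ s₁ s₂ s₃ (i + y)) (*-comm 4 x)) (signPattern-periodic i x)

runs₀ : List Run
runs₀ = (4 x+ 8 , 0 x+ 1 , 2 x+ 4) ∷ (0 x+ 1 , 2 x+ 4 , 1 x+ 1) ∷ (1 x+ 4 , 0 x+ 2 , 1 x+ 0)
      ∷ (1 x+ 2 , 0 x+ 0 , 0 x+ 1) ∷ (2 x+ 4 , 2 x+ 2 , 0 x+ 1) ∷ (2 x+ 5 , 4 x+ 6 , 0 x+ 1) ∷ []

runs₁ : List Run
runs₁ = (4 x+ 10 , 4 x+ 7 , 0 x+ 1) ∷ (4 x+ 11 , 4 x+ 5 , 0 x+ 1) ∷ (4 x+ 12 , 0 x+ 1 , 2 x+ 2)
      ∷ (0 x+ 2 , 2 x+ 4 , 1 x+ 2) ∷ (1 x+ 4 , 0 x+ 2 , 1 x+ 0) ∷ (0 x+ 1 , 2 x+ 2 , 0 x+ 1)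
      ∷ (3 x+ 6 , 0 x+ 0 , 0 x+ 1) ∷ (2 x+ 5 , 4 x+ 8 , 0 x+ 1) ∷ []

runs₂ : List Run
runs₂ = (0 x+ 1 , 4 x+ 9 , 0 x+ 1) ∷ (0 x+ 2 , 4 x+ 7 , 0 x+ 1) ∷ (0 x+ 3 , 0 x+ 1 , 2 x+ 3)
      ∷ (2 x+ 6 , 4 x+ 8 , 0 x+ 1) ∷ (4 x+ 12 , 2 x+ 8 , 1 x+ 0) ∷ (5 x+ 12 , 0 x+ 2 , 1 x+ 2)
      ∷ (6 x+ 14 , 2 x+ 6 , 0 x+ 1) ∷ (7 x+ 18 , 0 x+ 0 , 0 x+ 1) ∷ []

runs₃ : List Run
runs₃ = (0 x+ 1 , 0 x+ 1 , 2 x+ 3) ∷ (2 x+ 4 , 4 x+ 6 , 0 x+ 1) ∷ (4 x+ 8 , 2 x+ 4 , 1 x+ 1)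
      ∷ (5 x+ 9 , 0 x+ 0 , 0 x+ 1) ∷ (5 x+ 11 , 0 x+ 2 , 1 x+ 0) ∷ (6 x+ 12 , 2 x+ 2 , 0 x+ 1) ∷ []

skolem₀ : ∀ x → IsSkolemSequence (8 + 4 * x) 0 (pairsAt x runs₀)
skolem₀ = pairsAt-isSkolemSequence 0 runs₀ (4 x+ 8) (2 x+ 4) (2 x+ 4) (8 x+ 15) refl (inj₁ refl) refl _ _

skolem₁ : ∀ x → IsSkolemSequence (9 + 4 * x) 0 (pairsAt x runs₁)
skolem₁ = pairsAt-isSkolemSequence 0 runs₁ (4 x+ 9) (2 x+ 5) (2 x+ 4) (8 x+ 17) refl (inj₂ refl) refl _ _

skolem₂ : ∀ x → IsSkolemSequence (10 + 4 * x) 1 (pairsAt x runs₂)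
skolem₂ = pairsAt-isSkolemSequence 1 runs₂ (4 x+ 10) (2 x+ 5) (2 x+ 5) (8 x+ 19) refl (inj₁ refl) refl _ _

skolem₃ : ∀ x → IsSkolemSequence (7 + 4 * x) 1 (pairsAt x runs₃)
skolem₃ = pairsAt-isSkolemSequence 1 runs₃ (4 x+ 7) (2 x+ 4) (2 x+ 3) (8 x+ 13) refl (inj₂ refl) refl _ _

-- In runs₁, runs₂, small₅ and small₆ the first two pairs are the A and B of zeroSum-exceptional.
small₃ small₄ small₅ small₆ : List Pair
small₃ = (1 , 3) ∷ (2 , 1) ∷ (5 , 2) ∷ []
small₄ = (1 , 4) ∷ (2 , 2) ∷ (3 , 3) ∷ (7 , 1) ∷ []
small₅ = (8 , 1) ∷ (3 , 2) ∷ (2 , 5) ∷ (6 , 4) ∷ (1 , 3) ∷ []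
small₆ = (1 , 6) ∷ (2 , 4) ∷ (3 , 5) ∷ (10 , 3) ∷ (9 , 2) ∷ (4 , 1) ∷ []

skolem-small₃ : IsSkolemSequence 3 1 small₃
skolem-small₃ =
  pairsAt-isSkolemSequence 1 (map pairRun small₃) (0 x+ 3) (0 x+ 2) (0 x+ 1) (0 x+ 5) refl (inj₂ refl) refl _ _ 0

skolem-small₄ : IsSkolemSequence 4 0 small₄
skolem-small₄ =
  pairsAt-isSkolemSequence 0 (map pairRun small₄) (0 x+ 4) (0 x+ 2) (0 x+ 2) (0 x+ 7) refl (inj₁ refl) refl _ _ 0

skolem-small₅ : IsSkolemSequence 5 0 small₅
skolem-small₅ =
  pairsAt-isSkolemSequence 0 (map pairRun small₅) (0 x+ 5) (0 x+ 3) (0 x+ 2) (0 x+ 9) refl (inj₂ refl) refl _ _ 0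

skolem-small₆ : IsSkolemSequence 6 1 small₆
skolem-small₆ =
  pairsAt-isSkolemSequence 1 (map pairRun small₆) (0 x+ 6) (0 x+ 3) (0 x+ 3) (0 x+ 11) refl (inj₁ refl) refl _ _ 0

order₀ : ∀ k m → ZeroSumSkolemSystem (suc m * 4) k 0
order₀ k zero    = zeroSum-signed k 0 4 signs₀ small₄ (s≤s z≤n) skolem-small₄ (signedSum-signs₀ 1)
order₀ k (suc x) = zeroSum-signed k 0 (8 + x * 4) signs₀ (pairsAt x runs₀) (s≤s z≤n)
  (subst (λ n → IsSkolemSequence n 0 (pairsAt x runs₀)) (cong (_+_ 8) (*-comm 4 x)) (skolem₀ x))
  (signedSum-signs₀ (2 + x))

order₁ : ∀ k m → ZeroSumSkolemSystem (1 + suc m * 4) k 0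
order₁ k zero    =
  zeroSum-exceptional k 0 5 signs₁ 5 8 1 3 2 _ (s≤s z≤n) skolem-small₅ (signedSum-signs₁ 1) refl refl refl
order₁ k (suc x) = zeroSum-exceptional k 0 (9 + x * 4) signs₁ (9 + x * 4) _ _ _ _ _ (s≤s z≤n)
  (subst (λ n → IsSkolemSequence n 0 (pairsAt x runs₁)) (cong (_+_ 9) (*-comm 4 x)) (skolem₁ x))
  (signedSum-signs₁ (2 + x)) (cong not (signPattern-+4* 8 x)) (cong not (signPattern-+4* 6 x)) (balance x)
  where
  balance : ∀ x → 11 + 4 * x + (9 + x * 4) + (6 + 4 * x) ≡ 10 + 4 * x + (8 + 4 * x) + (8 + 4 * x)
  balance = solve-∀

order₂ : ∀ k m → ZeroSumSkolemSystem (2 + suc m * 4) k 1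
order₂ k zero    =
  zeroSum-exceptional k 1 6 signs₂ 7 1 6 2 4 _ (s≤s z≤n) skolem-small₆ (signedSum-signs₂ 1) refl refl refl
order₂ k (suc x) = zeroSum-exceptional k 1 (10 + x * 4) signs₂ (11 + x * 4) _ _ _ _ _ (s≤s z≤n)
  (subst (λ n → IsSkolemSequence n 1 (pairsAt x runs₂)) (cong (_+_ 10) (*-comm 4 x)) (skolem₂ x))
  (signedSum-signs₂ (2 + x)) (cong not (signPattern-+4* 10 x)) (cong not (signPattern-+4* 8 x)) (balance x)
  where
  balance : ∀ x → 2 + (11 + x * 4) + (8 + 4 * x) ≡ 1 + (10 + 4 * x) + (10 + 4 * x)
  balance = solve-∀

order₃ : ∀ k m → ZeroSumSkolemSystem (3 + m * 4) k 1
order₃ k zero    = zeroSum-signed k 1 3 signs₃ small₃ (s≤s z≤n) skolem-small₃ (signedSum-signs₃ 0)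
order₃ k (suc x) = zeroSum-signed k 1 (7 + x * 4) signs₃ (pairsAt x runs₃) (s≤s z≤n)
  (subst (λ n → IsSkolemSequence n 1 (pairsAt x runs₃)) (cong (_+_ 7) (*-comm 4 x)) (skolem₃ x))
  (signedSum-signs₃ (suc x))

by-residue : ∀ k t r q → r < 4 → 3 ≤ r + q * 4 → t ≤ 1 → (3 * r) % 4 ≡ t ⊎ (3 * r) % 4 ≡ 3 ∸ t →
  ZeroSumSkolemSystem (r + q * 4) k t
by-residue k 0 0 (suc q) _ _ _ _ = order₀ k q
by-residue k 0 1 (suc q) _ _ _ _ = order₁ k q
by-residue k 1 2 (suc q) _ _ _ _ = order₂ k q
by-residue k 1 3 q       _ _ _ _ = order₃ k q
by-residue k t 0 zero _ () _ _
by-residue k t 1 zero _ (s≤s ()) _ _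
by-residue k t 2 zero _ (s≤s (s≤s ())) _ _
by-residue k 0 2 q _ _ _ (inj₁ ())
by-residue k 0 2 q _ _ _ (inj₂ ())
by-residue k 0 3 q _ _ _ (inj₁ ())
by-residue k 0 3 q _ _ _ (inj₂ ())
by-residue k 1 0 q _ _ _ (inj₁ ())
by-residue k 1 0 q _ _ _ (inj₂ ())
by-residue k 1 1 q _ _ _ (inj₁ ())
by-residue k 1 1 q _ _ _ (inj₂ ())
by-residue k (suc (suc t)) r q _ _ (s≤s ()) _
by-residue k t (suc (suc (suc (suc r)))) q (s≤s (s≤s (s≤s (s≤s ())))) _ _ _

lemma30 : (k n t : ℕ) → n ≥ 3 → t ≤ 1 →
    ((3 * n) % 4 ≡ t ⊎ (3 * n) % 4 ≡ 3 ∸ t) →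
    ∃ λ (D : Fin n → List ℤ) → Is3SkolemSystem n k t D × IsZeroSum D
lemma30 k n t n≥3 t≤1 hook-condition =
  subst (λ n → ZeroSumSkolemSystem n k t) (sym n≡r+q*4)
    (by-residue k t (n % 4) (n / 4) (m%n<n n 4) (subst (3 ≤_) n≡r+q*4 n≥3) t≤1
      (Sum.map (trans (sym 3n%4≡3r%4)) (trans (sym 3n%4≡3r%4)) hook-condition))
  where
  n≡r+q*4 : n ≡ n % 4 + n / 4 * 4
  n≡r+q*4 = m≡m%n+[m/n]*n n 4
  3n%4≡3r%4 : (3 * n) % 4 ≡ (3 * (n % 4)) % 4
  3n%4≡3r%4 = %-distribˡ-* 3 n 4
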